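{- For fixed graphs $T$ and $F$ without isolated vertices, \(\operatorname{ex}(n,T,F)=|\mathcal T_{T,n}|-\alpha_T(C_{F,n})\). Equivalently, \[\operatorname{ex}(n,T,F)=\max_{\substack{y_M\in C_{F,n}\\ y_M\text{ squarefree}}}\dim_{\mathbf{k}} \pi_M(V_T(n)).\]
   Context: Let $\mathbf{k}$ be a field of characteristic zero, $R_n^{(2)}=\mathbf{k}[y_e:e\in E(K_n)]$, and for an edge set $A$ write $y_A=\prod_{e\in A}y_e$. Let $\mathcal T_{T,n}$ (resp. $\mathcal C_{F,n}$) be the set of edge sets of all copies of $T$ (resp. $F$) in $K_n$. Let $C_{F,n}=\bigcap_{A\in\mathcal C_{F,n}}(y_e:e\in A)$ be the cover ideal. Let $V_T(n)=\operatorname{span}_{\mathbf{k}}\{y_B:B\in\mathcal T_{T,n}\}$. For $M\subseteq E(K_n)$, put $\mathfrak m_M=(y_e:e\in M)$ and let $\pi_M:R_n^{(2)}\to R_n^{(2)}/\mathfrak m_M$ be the quotient map. Define $\alpha_T(C_{F,n})=\min\{\dim_{\mathbf{k}}(V_T(n)\cap\mathfrak m_M): y_M\in C_{F,n}$ squarefree$\}$ $=\min \dim_{\mathbf{k}}\ker(\pi_M|_{V_T(n)})$. $\operatorname{ex}(n,T,F)$ is the maximum number of copies of $T$ in an $F$-free graph on $n$ vertices. -}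

module Defs where

open import Level using (Level; _⊔_) renaming (suc to lsuc)
open import Data.Nat as ℕ using (ℕ; zero; suc; _<ᵇ_; _≡ᵇ_)
open import Data.Bool using (Bool; true; false; _∧_; _∨_; not; if_then_else_)
open import Data.Fin using (Fin; toℕ)
open import Data.Fin.Subset using (Subset; _⊆_)
open import Data.Fin.Subset.Properties using (_⊆?_)
open import Data.Vec as Vec using (Vec; []; _∷_; lookup; tabulate)
import Data.Vec.Properties as VecP
open import Data.Bool.Properties using () renaming (_≟_ to _≟B_)
open import Data.List as List using (List; []; _∷_; length; map; filter; concatMap; allFin; foldr; zipWith; deduplicate)
open import Data.List.Membership.Propositional using (_∈_)
open import Data.Product using (Σ; _×_; _,_; proj₁; proj₂)
open import Relation.Nullary using (¬_; Dec; yes; no)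
open import Relation.Nullary.Decidable using (⌊_⌋)
open import Relation.Binary.PropositionalEquality using (_≡_)
open import Algebra.Bundles using (CommutativeRing)

record Field (c ℓ : Level) : Set (lsuc (c ⊔ ℓ)) where
  field
    commRing : CommutativeRing c ℓ
  open CommutativeRing commRing public
  field
    0≉1     : ¬ (0# ≈ 1#)
    inverse : ∀ x → ¬ (x ≈ 0#) → Σ Carrier λ y → x * y ≈ 1#

natCast : ∀ {c ℓ} (K : Field c ℓ) → ℕ → Field.Carrier K
natCast K zero    = Field.0# K
natCast K (suc n) = Field._+_ K (Field.1# K) (natCast K n)

CharZero : ∀ {c ℓ} → Field c ℓ → Set ℓ
CharZero K = ∀ n → ¬ (Field._≈_ K (natCast K (suc n)) (Field.0# K))

record Graph : Set where
  field
    v     : ℕ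
    adj   : Fin v → Fin v → Bool
    sym   : ∀ x y → adj x y ≡ adj y x
    irrefl : ∀ x → adj x x ≡ false

NoIsolated : Graph → Set
NoIsolated G = (0 ℕ.< Graph.v G) × (∀ x → Σ (Fin (Graph.v G)) λ y → Graph.adj G x y ≡ true)

anyᵇ allᵇ : ∀ {a} {A : Set a} → (A → Bool) → List A → Bool
anyᵇ p = foldr (λ x b → p x ∨ b) false
allᵇ p = foldr (λ x b → p x ∧ b) true

_==_ : ∀ {n} → Fin n → Fin n → Bool
i == j = toℕ i ≡ᵇ toℕ j

edges : (n : ℕ) → List (Fin n × Fin n)
edges n = concatMap (λ i → map (λ j → (i , j)) (filter (λ j → toℕ i ℕ.<? toℕ j) (allFin n))) (allFin n)

E : ℕ → ℕ
E n = length (edges n)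

edgeAt : ∀ {n} → Fin (E n) → Fin n × Fin n
edgeAt {n} k = List.lookup (edges n) k

EdgeSet : ℕ → Set
EdgeSet n = Subset (E n)

edgeSetOf : ∀ {n} → (Fin n → Fin n → Bool) → EdgeSet n
edgeSetOf {n} f = tabulate λ k → f (proj₁ (edgeAt k)) (proj₂ (edgeAt k))

allMaps : (a n : ℕ) → List (Vec (Fin n) a)
allMaps zero    n = [] ∷ []
allMaps (suc a) n = concatMap (λ i → map (i ∷_) (allMaps a n)) (allFin n)

injectiveᵇ : ∀ {a n} → Vec (Fin n) a → Bool
injectiveᵇ {a} φ = allᵇ (λ i → allᵇ (λ j → (i == j) ∨ not (lookup φ i == lookup φ j)) (allFin a)) (allFin a)

imageEdges : ∀ {n} (G : Graph) → Vec (Fin n) (Graph.v G) → EdgeSet n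
imageEdges G φ = edgeSetOf λ x y →
  anyᵇ (λ u → anyᵇ (λ w → Graph.adj G u w ∧ (lookup φ u == x) ∧ (lookup φ w == y)) (allFin (Graph.v G))) (allFin (Graph.v G))

_≟ES_ : ∀ {n} (A B : EdgeSet n) → Dec (A ≡ B)
_≟ES_ = VecP.≡-dec _≟B_

-- 𝒯_{G,n}: the (distinct) edge sets of all copies of G in K_n
copies : (G : Graph) (n : ℕ) → List (EdgeSet n)
copies G n = deduplicate (_≟ES_ {n}) (map (imageEdges G) (filter (λ φ → Data.Bool.T? (injectiveᵇ φ)) (allMaps (Graph.v G) n)))
  where import Data.Bool

allSubsets : (m : ℕ) → List (Subset m)
allSubsets zero    = [] ∷ []
allSubsets (suc m) = concatMap (λ b → map (b ∷_) (allSubsets m)) (true ∷ false ∷ [])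

copiesIn : (T : Graph) {n : ℕ} → EdgeSet n → ℕ
copiesIn T {n} H = length (filter (λ B → B ⊆? H) (copies T n))

FFreeᵇ : (F : Graph) {n : ℕ} → EdgeSet n → Bool
FFreeᵇ F {n} H = allᵇ (λ A → not ⌊ A ⊆? H ⌋) (copies F n)

ex : (n : ℕ) (T F : Graph) → ℕ
ex n T F = foldr ℕ._⊔_ 0 (map (copiesIn T {n}) (filter (λ H → Data.Bool.T? (FFreeᵇ F {n} H)) (allSubsets (E n))))
  where import Data.Bool

-- The polynomial ring R_n^(2) = K[y_e : e ∈ E(K_n)]
-- Polynomials are formal finite sums of terms c·y^μ (μ an exponent vector),
-- with equality meaning equality of all coefficients.

module Poly {c ℓ} (K : Field c ℓ) (m : ℕ) where
  open Field K

  Mono : Set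
  Mono = Vec ℕ m

  Pol : Set c
  Pol = List (Carrier × Mono)

  coeff : Pol → Mono → Carrier
  coeff p μ = foldr (λ t acc → if ⌊ VecP.≡-dec ℕ._≟_ (proj₂ t) μ ⌋ then proj₁ t + acc else acc) 0# p

  _≈P_ : Pol → Pol → Set ℓ
  p ≈P q = ∀ μ → coeff p μ ≈ coeff q μ

  0P : Pol
  0P = []

  _+P_ : Pol → Pol → Pol
  _+P_ = List._++_

  _·P_ : Carrier → Pol → Pol
  a ·P p = map (λ t → (a * proj₁ t , proj₂ t)) p

  _*P_ : Pol → Pol → Pol
  p *P q = concatMap (λ s → map (λ t → (proj₁ s * proj₁ t , Vec.zipWith ℕ._+_ (proj₂ s) (proj₂ t))) q) p

  y : Fin m → Pol
  y e = (1# , tabulate (λ k → if k == e then 1 else 0)) ∷ []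

  yS : Subset m → Pol
  yS A = (1# , Vec.map (λ b → if b then 1 else 0) A) ∷ []

  InVarIdeal : Subset m → Pol → Set (c ⊔ ℓ)
  InVarIdeal A p = Σ (Fin m → Pol) λ q →
    p ≈P foldr _+P_ 0P (map (λ e → if lookup A e then y e *P q e else 0P) (allFin m))

  InCoverIdeal : List (Subset m) → Pol → Set (c ⊔ ℓ)
  InCoverIdeal 𝒜 p = ∀ A → A ∈ 𝒜 → InVarIdeal A p

  lincomb : ∀ {d} → Vec Carrier d → Vec Pol d → Pol
  lincomb cs ps = Vec.foldr _ _+P_ 0P (Vec.zipWith _·P_ cs ps)

  InSpan : ∀ {d} → Vec Pol d → Pol → Set (c ⊔ ℓ)
  InSpan {d} ps p = Σ (Vec Carrier d) λ cs → p ≈P lincomb cs ps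

  LinIndep : ∀ {d} → Vec Pol d → Set (c ⊔ ℓ)
  LinIndep {d} ps = ∀ cs → lincomb cs ps ≈P 0P → ∀ i → lookup cs i ≈ 0#

  HasDim : (Pol → Set (c ⊔ ℓ)) → ℕ → Set (c ⊔ ℓ)
  HasDim S d = Σ (Vec Pol d) λ bs →
    (∀ i → S (lookup bs i)) × LinIndep bs × (∀ p → S p → InSpan bs p)

module _ {c ℓ} (K : Field c ℓ) (n : ℕ) where
  open Poly K (E n)

  InV : Graph → Pol → Set (c ⊔ ℓ)
  InV T = InSpan (Vec.fromList (map yS (copies T n)))

  -- y_M ∈ C_{F,n}  (y_M is squarefree since M is a set of edges)
  yMInCover : Graph → EdgeSet n → Set (c ⊔ ℓ)
  yMInCover F M = InCoverIdeal (copies F n) (yS M)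

  dimVcapM : Graph → EdgeSet n → ℕ → Set (c ⊔ ℓ)
  dimVcapM T M d = HasDim (λ p → InV T p × InVarIdeal M p) d

  IsAlpha : Graph → Graph → ℕ → Set (c ⊔ ℓ)
  IsAlpha T F a =
    (Σ (EdgeSet n) λ M → yMInCover F M × dimVcapM T M a) ×
    (∀ M d → yMInCover F M → dimVcapM T M d → a ℕ.≤ d)

module Submission where

-- Fix a squarefree y_M. The monomials y_B of the copies B of T that share an edge with M
-- form a basis of V_T(n) ∩ 𝔪_M: they lie in it, distinct squarefree monomials are
-- linearly independent, and no polynomial of 𝔪_M contains a monomial y_B with B disjoint
-- from M. So dim (V_T(n) ∩ 𝔪_M) = |𝒯_{T,n}| minus the number of copies of T inside the
-- complement of M. Since y_M ∈ C_{F,n} exactly when the complement of M is F-free,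
-- minimising this dimension amounts to maximising the number of copies of T over F-free
-- graphs, which is ex(n,T,F). As F has an edge, the empty graph is F-free and the maximum
-- is attained.
--
-- Dimensions are compared through the exchange lemma (k independent vectors in the span
-- of d vectors force k ≤ d), proved by Gaussian elimination.

open import Defs
open import Level using (_⊔_)
open import Function using (_∘_; case_of_)
open import Function.Bundles using (Equivalence)
open import Data.Empty using (⊥-elim)
open import Data.Product using (Σ; ∃; _×_; proj₁; proj₂; _,_)
open import Data.Sum using (inj₁; inj₂)
open import Data.Bool using (Bool; true; false; if_then_else_; T; not; _∧_; _∨_)
open import Data.Bool.Properties using (T-∨; T-∧; T-≡)
open import Data.Bool.ListAction using (all; any)
open import Data.Nat as ℕ using (ℕ; zero; suc; _<_; s≤s)
import Data.Nat.Properties as ℕₚ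
open import Data.Fin as Fin using (Fin; zero; suc; punchIn; toℕ)
open import Data.Fin.Properties using (all?; ¬∀⟶∃¬; punchInᵢ≢i; toℕ-injective)
open import Data.Fin.Subset using (Subset; Nonempty; ∁; ⊥; _⊆_; _∩_) renaming (_∈_ to _∈ₛ_; _∉_ to _∉ₛ_)
open import Data.Fin.Subset.Properties using (_⊆?_; nonempty?; x∈p∩q⁺; x∈p∩q⁻; x∉p⇒x∈∁p; x∈∁p⇒x∉p; x∉∁p⇒x∈p; ∉⊥; ∪-∩-booleanAlgebra)
open import Data.Vec as Vec using (Vec; []; _∷_; lookup; tabulate; _[_]≔_)
open import Data.Vec.Properties using (≡-dec; ∷-injectiveʳ; lookup∘tabulate; lookup⇒[]=; []=⇒lookup; lookup-map; lookup-zipWith; lookup∘update; lookup∘update′)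
open import Data.Vec.Relation.Binary.Pointwise.Extensional using (ext; Pointwise-≡⇒≡)
open import Data.Vec.Functional using (insertAt; removeAt)
open import Data.Vec.Functional.Properties using (insertAt-lookup; insertAt-punchIn)
open import Data.List as List using (List; []; _∷_; foldr; length)
open import Data.List.Properties using (map-tabulate; length-map)
open import Data.List.Membership.Propositional using (_∈_; _∉_; lose)
open import Data.List.Membership.Propositional.Properties using (∈-allFin; ∈-concat⁺′; ∈-map⁺; ∈-map⁻; ∈-filter⁺; ∈-filter⁻; ∈-deduplicate⁻; ∈-++⁺ˡ; ∈-++⁺ʳ; foldr-selective)
open import Data.List.Relation.Unary.All as All using (All; []; _∷_; universal)
open import Data.List.Relation.Unary.All.Properties using (concat⁺; map⁺; ++⁺; All¬⇒¬Any; all⁺; all⁻)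
open import Data.List.Relation.Unary.Any as Any using (here; there)
open import Data.List.Relation.Unary.Any.Properties using (any⁺; lookup-index)
open import Data.List.Relation.Unary.AllPairs using ([]; _∷_)
open import Data.List.Relation.Unary.Unique.Propositional using (Unique)
open import Data.List.Relation.Unary.Unique.Propositional.Properties using (filter⁺)
open import Data.List.Relation.Unary.Unique.DecPropositional.Properties using (deduplicate-!)
open import Relation.Nullary using (¬_; ¬?; yes; no; does)
open import Relation.Nullary.Decidable using (T?; ⌊_⌋; ¬¬-excluded-middle; dec-true; dec-false; toWitnessFalse; fromWitnessFalse; decidable-stable)
open import Relation.Unary using (Pred; Decidable)
open import Relation.Binary.Definitions using (tri<; tri≈; tri>)
open import Relation.Binary.PropositionalEquality as ≡ using (_≡_; _≢_)

==-≟ : ∀ {k} (i j : Fin k) → (i == j) ≡ does (i Fin.≟ j)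
==-≟ zero    zero    = ≡.refl
==-≟ zero    (suc j) = ≡.refl
==-≟ (suc i) zero    = ≡.refl
==-≟ (suc i) (suc j) = ==-≟ i j

==⇒≡ : ∀ {k} {i j : Fin k} → T (i == j) → i ≡ j
==⇒≡ {i = i} {j} rewrite ==-≟ i j with i Fin.≟ j
... | yes i≡j = λ _ → i≡j
... | no  _   = λ ()

≡⇒== : ∀ {k} {i j : Fin k} → i ≡ j → T (i == j)
≡⇒== {i = i} {j} rewrite ==-≟ i j with i Fin.≟ j
... | yes _   = λ _ → _
... | no  i≢j = i≢j

not-==⇒≢ : ∀ {k} {i j : Fin k} → T (not (i == j)) → i ≢ j
not-==⇒≢ {i = i} {j} rewrite ==-≟ i j with i Fin.≟ j
... | yes _   = λ ()
... | no  i≢j = λ _ → i≢j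

allᵇ≡all : ∀ {a} {A : Set a} (p : A → Bool) xs → allᵇ p xs ≡ all p xs
allᵇ≡all p []       = ≡.refl
allᵇ≡all p (x ∷ xs) = ≡.cong (p x ∧_) (allᵇ≡all p xs)

anyᵇ≡any : ∀ {a} {A : Set a} (p : A → Bool) xs → anyᵇ p xs ≡ any p xs
anyᵇ≡any p []       = ≡.refl
anyᵇ≡any p (x ∷ xs) = ≡.cong (p x ∨_) (anyᵇ≡any p xs)

allᵇ⁻ : ∀ {a} {A : Set a} (p : A → Bool) {xs x} → T (allᵇ p xs) → x ∈ xs → T (p x)
allᵇ⁻ p {xs} all-p x∈xs = All.lookup (all⁺ p xs (≡.subst T (allᵇ≡all p xs) all-p)) x∈xs

allᵇ⁺ : ∀ {a} {A : Set a} (p : A → Bool) xs → (∀ {x} → x ∈ xs → T (p x)) → T (allᵇ p xs)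
allᵇ⁺ p xs all-p = ≡.subst T (≡.sym (allᵇ≡all p xs)) (all⁻ p (All.tabulate all-p))

anyᵇ⁺ : ∀ {a} {A : Set a} (p : A → Bool) {xs x} → x ∈ xs → T (p x) → T (anyᵇ p xs)
anyᵇ⁺ p {xs} x∈xs px = ≡.subst T (≡.sym (anyᵇ≡any p xs)) (any⁺ p (lose x∈xs px))

length-filter-¬?+length-filter : ∀ {a p} {A : Set a} {P : Pred A p} (P? : Decidable P) xs →
  length (List.filter (¬? ∘ P?) xs) ℕ.+ length (List.filter P? xs) ≡ length xs
length-filter-¬?+length-filter P? []       = ≡.refl
length-filter-¬?+length-filter P? (x ∷ xs) with P? x
... | yes _ = ≡.trans (ℕₚ.+-suc _ _) (≡.cong suc (length-filter-¬?+length-filter P? xs))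
... | no  _ = ≡.cong suc (length-filter-¬?+length-filter P? xs)

∈-allSubsets : ∀ {k} (H : Subset k) → H ∈ allSubsets k
∈-allSubsets []                = here ≡.refl
∈-allSubsets (true ∷ H)        = ∈-++⁺ˡ (∈-map⁺ (true ∷_) (∈-allSubsets H))
∈-allSubsets {suc k} (false ∷ H) =
  ∈-++⁺ʳ (List.map (true ∷_) (allSubsets k)) (∈-++⁺ˡ (∈-map⁺ (false ∷_) (∈-allSubsets H)))

≤-max : ∀ {a} {A : Set a} (f : A → ℕ) {xs x} → x ∈ xs → f x ℕ.≤ foldr ℕ._⊔_ 0 (List.map f xs)
≤-max f           (here ≡.refl)  = ℕₚ.m≤m⊔n _ _
≤-max f {y ∷ xs} (there x∈xs)   = ℕₚ.≤-trans (≤-max f x∈xs) (ℕₚ.m≤n⊔m (f y) _)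

max-attained : ∀ {a} {A : Set a} (f : A → ℕ) {xs x} → x ∈ xs →
  ∃ λ z → z ∈ xs × foldr ℕ._⊔_ 0 (List.map f xs) ≡ f z
max-attained f {xs} {x} x∈xs with foldr-selective ℕₚ.⊔-sel 0 (List.map f xs)
... | inj₂ max∈ = ∈-map⁻ f max∈
... | inj₁ max≡0 = x , x∈xs , ≡.trans max≡0 (≡.sym (ℕₚ.n≤0⇒n≡0 (≡.subst (f x ℕ.≤_) max≡0 (≤-max f x∈xs))))

+≡+⇒≤ : ∀ {a b c d} → a ℕ.+ b ≡ c ℕ.+ d → d ℕ.≤ b → a ℕ.≤ c
+≡+⇒≤ {a} {b} {c} {d} eq d≤b = ℕₚ.+-cancelʳ-≤ b a c (≡.subst (ℕ._≤ c ℕ.+ b) (≡.sym eq) (ℕₚ.+-monoʳ-≤ c d≤b))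

∉ₛ⇒lookup≡false : ∀ {k} {e : Fin k} {A : Subset k} → e ∉ₛ A → lookup A e ≡ false
∉ₛ⇒lookup≡false {e = e} {A} e∉A with lookup A e in eq
... | true  = ⊥-elim (e∉A (lookup⇒[]= e A eq))
... | false = ≡.refl

∁-involutive : ∀ {k} (H : Subset k) → ∁ (∁ H) ≡ H
∁-involutive {k} = ¬-involutive
  where open import Algebra.Lattice.Properties.BooleanAlgebra (∪-∩-booleanAlgebra k) using (¬-involutive)

¬⊆∁⇒meets : ∀ {k} {B M : Subset k} → ¬ B ⊆ ∁ M → ∃ λ e → e ∈ₛ B × e ∈ₛ M
¬⊆∁⇒meets {B = B} {M} B⊈∁M with nonempty? (B ∩ M)
... | yes (e , e∈B∩M) = e , x∈p∩q⁻ B M e∈B∩M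
... | no  B∩M-empty   = ⊥-elim (B⊈∁M λ e∈B → x∉p⇒x∈∁p λ e∈M → B∩M-empty (_ , x∈p∩q⁺ (e∈B , e∈M)))

indicator : ∀ {k} → Vec Bool k → Vec ℕ k
indicator = Vec.map (λ b → if b then 1 else 0)

indicator-injective : ∀ {k} (A B : Vec Bool k) → indicator A ≡ indicator B → A ≡ B
indicator-injective []          []          _  = ≡.refl
indicator-injective (true ∷ A)  (true ∷ B)  eq = ≡.cong (true ∷_) (indicator-injective A B (∷-injectiveʳ eq))
indicator-injective (false ∷ A) (false ∷ B) eq = ≡.cong (false ∷_) (indicator-injective A B (∷-injectiveʳ eq))

unitVec : ∀ {k} → Fin k → Vec ℕ k
unitVec e = tabulate (λ i → if i == e then 1 else 0)

lookup-unitVec : ∀ {k} (e i : Fin k) → lookup (unitVec e) i ≡ (if does (i Fin.≟ e) then 1 else 0)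
lookup-unitVec e i = ≡.trans (lookup∘tabulate _ i) (≡.cong (if_then 1 else 0) (==-≟ i e))

lookup-indicator : ∀ {k} (A : Vec Bool k) i → lookup (indicator A) i ≡ (if lookup A i then 1 else 0)
lookup-indicator A i = lookup-map i _ A

unitVec+indicator-remove : ∀ {k} {e : Fin k} {M} → e ∈ₛ M →
  Vec.zipWith ℕ._+_ (unitVec e) (indicator (M [ e ]≔ false)) ≡ indicator M
unitVec+indicator-remove {e = e} {M} e∈M = Pointwise-≡⇒≡ (ext pointwise)
  where
  pointwise : ∀ i → lookup (Vec.zipWith ℕ._+_ (unitVec e) (indicator (M [ e ]≔ false))) i ≡ lookup (indicator M) i
  pointwise i rewrite lookup-zipWith ℕ._+_ i (unitVec e) (indicator (M [ e ]≔ false))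
                    | lookup-unitVec e i | lookup-indicator (M [ e ]≔ false) i | lookup-indicator M i
                    with i Fin.≟ e
  ... | yes ≡.refl rewrite lookup∘update i M false | []=⇒lookup e∈M = ≡.refl
  ... | no i≢e     rewrite lookup∘update′ i≢e M false = ≡.refl

unitVec+≢indicator : ∀ {k} {e : Fin k} ν {B} → e ∉ₛ B → Vec.zipWith ℕ._+_ (unitVec e) ν ≢ indicator B
unitVec+≢indicator {e = e} ν {B} e∉B eq = ℕₚ.1+n≢0 (begin
  suc (lookup ν e)                                ≡⟨ ≡.cong (ℕ._+ lookup ν e) (≡.sym unit-at-e) ⟩
  lookup (unitVec e) e ℕ.+ lookup ν e             ≡⟨ ≡.sym (lookup-zipWith ℕ._+_ e (unitVec e) ν) ⟩
  lookup (Vec.zipWith ℕ._+_ (unitVec e) ν) e      ≡⟨ ≡.cong (λ v → lookup v e) eq ⟩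
  lookup (indicator B) e                          ≡⟨ lookup-indicator B e ⟩
  (if lookup B e then 1 else 0)                   ≡⟨ ≡.cong (if_then 1 else 0) (∉ₛ⇒lookup≡false e∉B) ⟩
  0                                               ∎)
  where
  open ≡.≡-Reasoning
  unit-at-e : lookup (unitVec e) e ≡ 1
  unit-at-e = ≡.trans (lookup-unitVec e e) (≡.cong (if_then 1 else 0) (dec-true (e Fin.≟ e) ≡.refl))

-- Linear algebra over a field

¬¬-decidable : ∀ {k p} (P : Pred (Fin k) p) → ¬ ¬ Decidable P
¬¬-decidable {zero}  P ¬dec = ¬dec λ ()
¬¬-decidable {suc k} P ¬dec =
  ¬¬-excluded-middle λ P0? → ¬¬-decidable (λ j → P (suc j)) λ P+? →
    ¬dec λ { zero → P0? ; (suc j) → P+? j }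

module LinearAlgebra {c ℓ} (K : Field c ℓ) where
  open Field K hiding (zero)
  open import Algebra.Properties.Ring ring using (-0#≈0#; -‿distribˡ-*; -‿distribʳ-*)
  open import Algebra.Properties.AbelianGroup +-abelianGroup using (⁻¹-∙-comm)
  open import Algebra.Properties.Semiring.Sum semiring public
    using (sum; sum-syntax; sum-cong-≋; sum-cong-≗; sum-replicate-zero; sum-remove; ∑-distrib-+; ∑-comm;
           *-distribˡ-sum; *-distribʳ-sum)
  open import Relation.Binary.Reasoning.Setoid setoid

  sum-≈0 : ∀ {k} {f : Fin k → Carrier} → (∀ j → f j ≈ 0#) → sum f ≈ 0#
  sum-≈0 {k} f≈0 = trans (sum-cong-≋ f≈0) (sum-replicate-zero k)

  sum-neg : ∀ {k} (f : Fin k → Carrier) → ∑[ j < k ] (- f j) ≈ - sum f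
  sum-neg {zero}  f = sym -0#≈0#
  sum-neg {suc k} f = trans (+-congˡ (sum-neg (λ j → f (suc j)))) (⁻¹-∙-comm _ _)

  sum-single : ∀ {k} (f : Fin k → Carrier) i → (∀ j → j ≢ i → f j ≈ 0#) → sum f ≈ f i
  sum-single {suc k} f i others≈0 = begin
    sum f                            ≈⟨ sum-remove {i = i} f ⟩
    f i + ∑[ j < k ] f (punchIn i j) ≈⟨ +-congˡ (sum-≈0 λ j → others≈0 _ (punchInᵢ≢i i j)) ⟩
    f i + 0#                         ≈⟨ +-identityʳ _ ⟩
    f i                              ∎

  combination : ∀ {k d} → (Fin k → Carrier) → (Fin k → Fin d → Carrier) → Fin d → Carrier
  combination {k} a A i = ∑[ j < k ] (a j * A j i)

  RowsIndependent : ∀ {k d} → (Fin k → Fin d → Carrier) → Set (c ⊔ ℓ)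
  RowsIndependent A = ∀ a → (∀ i → combination a A i ≈ 0#) → ∀ j → a j ≈ 0#

  combination-insertAt : ∀ {k d} (b : Fin k → Carrier) j₀ x (A : Fin (suc k) → Fin d → Carrier) i →
    combination (insertAt b j₀ x) A i ≈ x * A j₀ i + combination b (removeAt A j₀) i
  combination-insertAt b j₀ x A i = trans (sum-remove {i = j₀} (λ j → insertAt b j₀ x j * A j i))
    (reflexive (≡.cong₂ _+_ (≡.cong (_* A j₀ i) (insertAt-lookup b j₀ x))
      (sum-cong-≗ λ j → ≡.cong (_* A (punchIn j₀ j) i) (insertAt-punchIn b j₀ x j))))

  combination-outer-update : ∀ {k d} (b : Fin k → Carrier) (X : Fin k → Fin d → Carrier)
    (λ′ : Fin k → Carrier) (y : Fin d → Carrier) i →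
    combination b (λ j i → X j i - λ′ j * y i) i ≈ combination b X i - (∑[ j < k ] (b j * λ′ j)) * y i
  combination-outer-update {k} b X λ′ y i = begin
    ∑[ j < k ] (b j * (X j i - λ′ j * y i))
      ≈⟨ sum-cong-≋ pointwise ⟩
    ∑[ j < k ] (b j * X j i + - (b j * λ′ j * y i))
      ≈⟨ ∑-distrib-+ (λ j → b j * X j i) (λ j → - (b j * λ′ j * y i)) ⟩
    combination b X i + ∑[ j < k ] (- (b j * λ′ j * y i))
      ≈⟨ +-congˡ (sum-neg (λ j → b j * λ′ j * y i)) ⟩
    combination b X i - ∑[ j < k ] (b j * λ′ j * y i)
      ≈⟨ +-congˡ (-‿cong (sym (*-distribʳ-sum (y i) (λ j → b j * λ′ j)))) ⟩
    combination b X i - (∑[ j < k ] (b j * λ′ j)) * y i ∎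
    where
    pointwise : ∀ j → b j * (X j i - λ′ j * y i) ≈ b j * X j i + - (b j * λ′ j * y i)
    pointwise j = trans (distribˡ (b j) _ _)
      (+-congˡ (trans (sym (-‿distribʳ-* (b j) _)) (-‿cong (sym (*-assoc (b j) _ _)))))

  combination-eliminate : ∀ {k d} (b : Fin k → Carrier) j₀ (λ′ : Fin k → Carrier)
    (A : Fin (suc k) → Fin d → Carrier) i →
    combination (insertAt b j₀ (- ∑[ j < k ] (b j * λ′ j))) A i
      ≈ combination b (λ j i → removeAt A j₀ j i - λ′ j * A j₀ i) i
  combination-eliminate {k} b j₀ λ′ A i = begin
    combination (insertAt b j₀ (- s)) A i          ≈⟨ combination-insertAt b j₀ (- s) A i ⟩
    - s * A j₀ i + combination b (removeAt A j₀) i ≈⟨ +-comm _ _ ⟩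
    combination b (removeAt A j₀) i + - s * A j₀ i ≈⟨ +-congˡ (sym (-‿distribˡ-* s (A j₀ i))) ⟩
    combination b (removeAt A j₀) i - s * A j₀ i
      ≈⟨ sym (combination-outer-update b (removeAt A j₀) λ′ (A j₀) i) ⟩
    combination b (λ j i → removeAt A j₀ j i - λ′ j * A j₀ i) i ∎
    where
    s : Carrier
    s = ∑[ j < k ] (b j * λ′ j)

  -- Equality in K need not be decidable, but the goal is ⊥, so we may split cases under ¬¬:
  -- either the first column vanishes and is dropped, or a row with a nonzero pivot clears
  -- the first column of the other k − 1 rows, which stay independent.
  no-independent-rows : ∀ {k d} (A : Fin k → Fin d → Carrier) → d < k → ¬ RowsIndependent A
  no-independent-rows {suc k} {zero} A _ ind = 0≉1 (sym (ind (λ _ → 1#) (λ ()) zero))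
  no-independent-rows {suc k} {suc d} A (s≤s d<k) ind =
    ¬¬-decidable (λ j → A j zero ≈ 0#) λ zero? → case all? zero? of λ where
      (yes allZero) → no-independent-rows (λ j i → A j (suc i)) (ℕₚ.m<n⇒m<1+n d<k) (drop-zero-column allZero)
      (no ¬allZero) →
        let j₀ , pivot≉0 = ¬∀⟶∃¬ _ _ zero? ¬allZero
            p , πp≈1 = inverse (A j₀ zero) pivot≉0
        in no-independent-rows _ d<k (eliminate-pivot j₀ p πp≈1)
    where
    drop-zero-column : (∀ j → A j zero ≈ 0#) → RowsIndependent (λ j i → A j (suc i))
    drop-zero-column allZero a h = ind a λ where
      zero    → sum-≈0 λ j → trans (*-congˡ (allZero j)) (zeroʳ (a j))
      (suc i) → h i
    eliminate-pivot : ∀ j₀ p → A j₀ zero * p ≈ 1# →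
      RowsIndependent (λ j i → removeAt A j₀ j (suc i) - (removeAt A j₀ j zero * p) * A j₀ (suc i))
    eliminate-pivot j₀ p πp≈1 b h j =
      trans (reflexive (≡.sym (insertAt-punchIn b j₀ x j))) (ind a a·A≈0 (punchIn j₀ j))
      where
      λ′ : Fin k → Carrier
      λ′ j = removeAt A j₀ j zero * p
      x : Carrier
      x = - ∑[ j < k ] (b j * λ′ j)
      a : Fin (suc k) → Carrier
      a = insertAt b j₀ x
      cancels : ∀ y → y - (y * p) * A j₀ zero ≈ 0#
      cancels y = trans (+-congˡ (-‿cong (begin
        (y * p) * A j₀ zero ≈⟨ *-assoc y p _ ⟩
        y * (p * A j₀ zero) ≈⟨ *-congˡ (trans (*-comm p _) πp≈1) ⟩
        y * 1#              ≈⟨ *-identityʳ y ⟩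
        y ∎))) (-‿inverseʳ y)
      a·A≈0 : ∀ i → combination a A i ≈ 0#
      a·A≈0 i = trans (combination-eliminate b j₀ λ′ A i) (column i)
        where
        column : ∀ i → combination b (λ j i → removeAt A j₀ j i - λ′ j * A j₀ i) i ≈ 0#
        column zero    = sum-≈0 λ j → trans (*-congˡ (cancels (removeAt A j₀ j zero))) (zeroʳ (b j))
        column (suc i) = h i

-- Polynomials

module Polynomials {c ℓ} (K : Field c ℓ) (m : ℕ) where
  open Field K hiding (zero)
  open Poly K m
  open LinearAlgebra K
  open import Relation.Binary.Reasoning.Setoid setoid

  coeff-+P : ∀ p q μ → coeff (p +P q) μ ≈ coeff p μ + coeff q μ
  coeff-+P []            q μ = sym (+-identityˡ _)
  coeff-+P ((a , ν) ∷ p) q μ with ⌊ ≡-dec ℕ._≟_ ν μ ⌋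
  ... | true  = trans (+-congˡ (coeff-+P p q μ)) (sym (+-assoc _ _ _))
  ... | false = coeff-+P p q μ

  coeff-·P : ∀ a p μ → coeff (a ·P p) μ ≈ a * coeff p μ
  coeff-·P a []            μ = sym (zeroʳ a)
  coeff-·P a ((b , ν) ∷ p) μ with ⌊ ≡-dec ℕ._≟_ ν μ ⌋
  ... | true  = trans (+-congˡ (coeff-·P a p μ)) (sym (distribˡ a _ _))
  ... | false = coeff-·P a p μ

  coeff-lincomb : ∀ {d} (cs : Vec Carrier d) (ps : Vec Pol d) μ →
    coeff (lincomb cs ps) μ ≈ ∑[ i < d ] (lookup cs i * coeff (lookup ps i) μ)
  coeff-lincomb []       []       μ = refl
  coeff-lincomb (a ∷ cs) (p ∷ ps) μ =
    trans (coeff-+P (a ·P p) (lincomb cs ps) μ) (+-cong (coeff-·P a p μ) (coeff-lincomb cs ps μ))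

  coeff-sum : ∀ {k} (g : Fin k → Pol) μ → coeff (foldr _+P_ 0P (List.tabulate g)) μ ≈ ∑[ e < k ] coeff (g e) μ
  coeff-sum {zero}  g μ = refl
  coeff-sum {suc k} g μ = trans (coeff-+P (g zero) _ μ) (+-congˡ (coeff-sum (λ e → g (suc e)) μ))

  coeff-absent : ∀ p μ → All (λ t → proj₂ t ≢ μ) p → coeff p μ ≡ 0#
  coeff-absent []            μ []          = ≡.refl
  coeff-absent ((a , ν) ∷ p) μ (ν≢μ ∷ ν∉p) with ≡-dec ℕ._≟_ ν μ
  ... | yes ν≡μ = ⊥-elim (ν≢μ ν≡μ)
  ... | no _    = coeff-absent p μ ν∉p

  exponent : Subset m → Mono
  exponent = indicator

  y*P-∈-InVarIdeal : ∀ {A e} → e ∈ₛ A → ∀ r → InVarIdeal A (y e *P r)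
  y*P-∈-InVarIdeal {A} {e} e∈A r = q , λ μ → sym (begin
    coeff (foldr _+P_ 0P (List.map g (List.allFin m))) μ
      ≡⟨ ≡.cong (λ ps → coeff (foldr _+P_ 0P ps) μ) (map-tabulate (λ e′ → e′) g) ⟩
    coeff (foldr _+P_ 0P (List.tabulate g)) μ          ≈⟨ coeff-sum g μ ⟩
    ∑[ e′ < m ] coeff (g e′) μ
      ≈⟨ sum-single (λ e′ → coeff (g e′) μ) e (λ e′ e′≢e → reflexive (≡.cong (λ p → coeff p μ) (g-other e′ e′≢e))) ⟩
    coeff (g e) μ                                       ≡⟨ ≡.cong (λ p → coeff p μ) g-self ⟩
    coeff (y e *P r) μ                                  ∎)
    where
    q : Fin m → Pol
    q e′ = if does (e′ Fin.≟ e) then r else 0P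
    g : Fin m → Pol
    g e′ = if lookup A e′ then y e′ *P q e′ else 0P
    g-self : g e ≡ y e *P r
    g-self rewrite []=⇒lookup e∈A | dec-true (e Fin.≟ e) ≡.refl = ≡.refl
    g-other : ∀ e′ → e′ ≢ e → g e′ ≡ 0P
    g-other e′ e′≢e rewrite dec-false (e′ Fin.≟ e) e′≢e with lookup A e′
    ... | true  = ≡.refl
    ... | false = ≡.refl

  yS≈P-y*yS : ∀ {M e} → e ∈ₛ M → yS M ≈P (y e *P yS (M [ e ]≔ false))
  yS≈P-y*yS {M} {e} e∈M μ = begin
    coeff (yS M) μ                        ≈⟨ sym (*-identityˡ _) ⟩
    1# * coeff (yS M) μ                   ≈⟨ sym (coeff-·P 1# (yS M) μ) ⟩
    coeff (1# ·P yS M) μ                  ≡⟨ ≡.cong (λ ν → coeff ((1# * 1# , ν) ∷ []) μ) (≡.sym (unitVec+indicator-remove e∈M)) ⟩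
    coeff (y e *P yS (M [ e ]≔ false)) μ  ∎

  yS-∈-InVarIdeal : ∀ {A M e} → e ∈ₛ A → e ∈ₛ M → InVarIdeal A (yS M)
  yS-∈-InVarIdeal {M = M} {e} e∈A e∈M =
    let q , y*yS≈ = y*P-∈-InVarIdeal e∈A (yS (M [ e ]≔ false))
    in q , λ μ → trans (yS≈P-y*yS e∈M μ) (y*yS≈ μ)

  -- Every monomial of y_e · q_e has a positive exponent at e ∈ A, where y_B has exponent 0.
  InVarIdeal⇒coeff≈0 : ∀ {A B p} → InVarIdeal A p → (∀ {e} → e ∈ₛ A → e ∉ₛ B) → coeff p (exponent B) ≈ 0#
  InVarIdeal⇒coeff≈0 {A} {B} (q , p≈) A∩B=∅ =
    trans (p≈ (exponent B))
          (reflexive (coeff-absent _ _ (concat⁺ (map⁺ (universal generator-absent (List.allFin m))))))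
    where
    generator-absent : ∀ e → All (λ t → proj₂ t ≢ exponent B) (if lookup A e then y e *P q e else 0P)
    generator-absent e with lookup A e in e∈A
    ... | false = []
    ... | true  =
      ++⁺ (map⁺ (universal (λ t → unitVec+≢indicator (proj₂ t) (A∩B=∅ (lookup⇒[]= e A e∈A))) (q e))) []

  coeff-lincomb-∷ : ∀ {d} c (cs : Vec Carrier d) p ps μ →
    coeff (lincomb (c ∷ cs) (p ∷ ps)) μ ≈ c * coeff p μ + coeff (lincomb cs ps) μ
  coeff-lincomb-∷ c cs p ps μ = trans (coeff-+P (c ·P p) (lincomb cs ps) μ) (+-congʳ (coeff-·P c p μ))

  lincomb-∷-≈0 : ∀ {d c} (cs : Vec Carrier d) p ps → c ≈ 0# → lincomb (c ∷ cs) (p ∷ ps) ≈P lincomb cs ps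
  lincomb-∷-≈0 {c = c} cs p ps c≈0 μ = begin
    coeff (lincomb (c ∷ cs) (p ∷ ps)) μ         ≈⟨ coeff-lincomb-∷ c cs p ps μ ⟩
    c * coeff p μ + coeff (lincomb cs ps) μ     ≈⟨ +-congʳ (trans (*-congʳ c≈0) (zeroˡ _)) ⟩
    0# + coeff (lincomb cs ps) μ                ≈⟨ +-identityˡ _ ⟩
    coeff (lincomb cs ps) μ                     ∎

  lincomb-replicate-0# : ∀ {d} (ps : Vec Pol d) → lincomb (Vec.replicate d 0#) ps ≈P 0P
  lincomb-replicate-0# []       μ = refl
  lincomb-replicate-0# (p ∷ ps) μ = trans (lincomb-∷-≈0 (Vec.replicate _ 0#) p ps refl μ) (lincomb-replicate-0# ps μ)

  coeff-yS-self : ∀ A → coeff (yS A) (exponent A) ≈ 1#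
  coeff-yS-self A with ≡-dec ℕ._≟_ (exponent A) (exponent A)
  ... | yes _  = +-identityʳ 1#
  ... | no ≢ = ⊥-elim (≢ ≡.refl)

  coeff-yS-≢ : ∀ {A B} → A ≢ B → coeff (yS A) (exponent B) ≈ 0#
  coeff-yS-≢ {A} {B} A≢B with ≡-dec ℕ._≟_ (exponent A) (exponent B)
  ... | yes eq = ⊥-elim (A≢B (indicator-injective A B eq))
  ... | no _   = refl

  monomials : (Bs : List (Subset m)) → Vec Pol (length (List.map yS Bs))
  monomials Bs = Vec.fromList (List.map yS Bs)

  lookup-monomials : ∀ {q} (S : Pol → Set q) Bs → (∀ {B} → B ∈ Bs → S (yS B)) → ∀ i → S (lookup (monomials Bs) i)
  lookup-monomials S (B ∷ Bs) S-Bs zero    = S-Bs (here ≡.refl)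
  lookup-monomials S (B ∷ Bs) S-Bs (suc i) = lookup-monomials S Bs (S-Bs ∘ there) i

  coeff-monomials-absent : ∀ {B} Bs → B ∉ Bs → ∀ cs → coeff (lincomb cs (monomials Bs)) (exponent B) ≈ 0#
  coeff-monomials-absent []        _     []       = refl
  coeff-monomials-absent {B} (B′ ∷ Bs) B∉B′∷Bs (c ∷ cs) = begin
    coeff (lincomb (c ∷ cs) (monomials (B′ ∷ Bs))) (exponent B)   ≈⟨ coeff-lincomb-∷ c cs (yS B′) (monomials Bs) (exponent B) ⟩
    c * coeff (yS B′) (exponent B) + coeff (lincomb cs (monomials Bs)) (exponent B)
      ≈⟨ +-cong (*-congˡ (coeff-yS-≢ (B∉B′∷Bs ∘ here ∘ ≡.sym)))
                (coeff-monomials-absent Bs (B∉B′∷Bs ∘ there) cs) ⟩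
    c * 0# + 0#                                                   ≈⟨ trans (+-identityʳ _) (zeroʳ c) ⟩
    0#                                                            ∎

  coeff-monomials-head : ∀ {B Bs} → B ∉ Bs → ∀ c cs → coeff (lincomb (c ∷ cs) (monomials (B ∷ Bs))) (exponent B) ≈ c
  coeff-monomials-head {B} {Bs} B∉Bs c cs = begin
    coeff (lincomb (c ∷ cs) (monomials (B ∷ Bs))) (exponent B)
      ≈⟨ coeff-lincomb-∷ c cs (yS B) (monomials Bs) (exponent B) ⟩
    c * coeff (yS B) (exponent B) + coeff (lincomb cs (monomials Bs)) (exponent B)
      ≈⟨ +-cong (*-congˡ (coeff-yS-self B))
                (coeff-monomials-absent Bs B∉Bs cs) ⟩
    c * 1# + 0#
      ≈⟨ trans (+-identityʳ _) (*-identityʳ c) ⟩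
    c ∎

  monomials-independent : ∀ Bs → Unique Bs → LinIndep (monomials Bs)
  monomials-independent (B ∷ Bs) (B≢Bs ∷ unique) (c ∷ cs) comb≈0 = λ where
      zero    → c≈0
      (suc i) → monomials-independent Bs unique cs
                  (λ μ → trans (sym (lincomb-∷-≈0 cs (yS B) (monomials Bs) c≈0 μ)) (comb≈0 μ)) i
    where
    c≈0 : c ≈ 0#
    c≈0 = trans (sym (coeff-monomials-head (All¬⇒¬Any B≢Bs) c cs)) (comb≈0 (exponent B))

  yS-∈-span : ∀ {B} Bs → B ∈ Bs → InSpan (monomials Bs) (yS B)
  yS-∈-span {B} (B ∷ Bs) (here ≡.refl) = 1# ∷ Vec.replicate _ 0# , λ μ → sym (begin
    coeff (lincomb (1# ∷ Vec.replicate _ 0#) (monomials (B ∷ Bs))) μ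
      ≈⟨ coeff-lincomb-∷ 1# (Vec.replicate _ 0#) (yS B) (monomials Bs) μ ⟩
    1# * coeff (yS B) μ + coeff (lincomb (Vec.replicate _ 0#) (monomials Bs)) μ
      ≈⟨ +-cong (*-identityˡ _) (lincomb-replicate-0# (monomials Bs) μ) ⟩
    coeff (yS B) μ + 0#
      ≈⟨ +-identityʳ _ ⟩
    coeff (yS B) μ ∎)
  yS-∈-span (B′ ∷ Bs) (there B∈Bs) =
    let cs , yS≈ = yS-∈-span Bs B∈Bs
    in 0# ∷ cs , λ μ → trans (yS≈ μ) (sym (lincomb-∷-≈0 cs (yS B′) (monomials Bs) refl μ))

  lincomb-∈-span-filter : ∀ {p} {P : Pred (Subset m) p} (P? : Decidable P) Bs → Unique Bs → ∀ cs →
    (∀ {B} → B ∈ Bs → ¬ P B → coeff (lincomb cs (monomials Bs)) (exponent B) ≈ 0#) →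
    InSpan (monomials (List.filter P? Bs)) (lincomb cs (monomials Bs))
  lincomb-∈-span-filter P? []       []                []       _        = [] , λ μ → refl
  lincomb-∈-span-filter P? (B ∷ Bs) (B≢Bs ∷ unique) (c ∷ cs) off-P≈0
    with lincomb-∈-span-filter P? Bs unique cs tail-off-P≈0 | P? B
    where
    tail-off-P≈0 : ∀ {B′} → B′ ∈ Bs → ¬ _ → coeff (lincomb cs (monomials Bs)) (exponent B′) ≈ 0#
    tail-off-P≈0 {B′} B′∈Bs ¬PB′ = begin
      coeff (lincomb cs (monomials Bs)) (exponent B′)
        ≈⟨ sym (+-identityˡ _) ⟩
      0# + coeff (lincomb cs (monomials Bs)) (exponent B′)
        ≈⟨ +-congʳ (trans (sym (zeroʳ c)) (*-congˡ (sym (coeff-yS-≢ (All.lookup B≢Bs B′∈Bs))))) ⟩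
      c * coeff (yS B) (exponent B′) + coeff (lincomb cs (monomials Bs)) (exponent B′)
        ≈⟨ sym (coeff-lincomb-∷ c cs (yS B) (monomials Bs) (exponent B′)) ⟩
      coeff (lincomb (c ∷ cs) (monomials (B ∷ Bs))) (exponent B′)
        ≈⟨ off-P≈0 (there B′∈Bs) ¬PB′ ⟩
      0# ∎
  ... | cs′ , tail≈ | yes _ = c ∷ cs′ , λ μ → begin
    coeff (lincomb (c ∷ cs) (monomials (B ∷ Bs))) μ          ≈⟨ coeff-lincomb-∷ c cs (yS B) (monomials Bs) μ ⟩
    c * coeff (yS B) μ + coeff (lincomb cs (monomials Bs)) μ ≈⟨ +-congˡ (tail≈ μ) ⟩
    c * coeff (yS B) μ + coeff (lincomb cs′ (monomials (List.filter P? Bs))) μ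
      ≈⟨ sym (coeff-lincomb-∷ c cs′ (yS B) (monomials (List.filter P? Bs)) μ) ⟩
    coeff (lincomb (c ∷ cs′) (monomials (B ∷ List.filter P? Bs))) μ ∎
  ... | cs′ , tail≈ | no ¬PB = cs′ , λ μ → trans (lincomb-∷-≈0 cs (yS B) (monomials Bs) c≈0 μ) (tail≈ μ)
    where
    c≈0 : c ≈ 0#
    c≈0 = trans (sym (coeff-monomials-head (All¬⇒¬Any B≢Bs) c cs)) (off-P≈0 (here ≡.refl) ¬PB)

  LinIndep-in-span⇒≤ : ∀ {k d} (us : Vec Pol k) (ws : Vec Pol d) →
    LinIndep us → (∀ j → InSpan ws (lookup us j)) → k ℕ.≤ d
  LinIndep-in-span⇒≤ {k} {d} us ws us-independent us∈span =
    ℕₚ.≮⇒≥ λ d<k → no-independent-rows A d<k A-independent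
    where
    A : Fin k → Fin d → Carrier
    A j = lookup (proj₁ (us∈span j))
    w : Fin d → Mono → Carrier
    w i μ = coeff (lookup ws i) μ
    A-independent : RowsIndependent A
    A-independent a a·A≈0 j =
      trans (reflexive (≡.sym (lookup∘tabulate a j))) (us-independent (tabulate a) a·us≈0 j)
      where
      a·us≈0 : lincomb (tabulate a) us ≈P 0P
      a·us≈0 μ = begin
        coeff (lincomb (tabulate a) us) μ
          ≈⟨ coeff-lincomb (tabulate a) us μ ⟩
        ∑[ j < k ] (lookup (tabulate a) j * coeff (lookup us j) μ)
          ≈⟨ sum-cong-≋ (λ j → *-cong (reflexive (lookup∘tabulate a j))
                                      (trans (proj₂ (us∈span j) μ) (coeff-lincomb (proj₁ (us∈span j)) ws μ))) ⟩
        ∑[ j < k ] (a j * ∑[ i < d ] (A j i * w i μ))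
          ≈⟨ sum-cong-≋ (λ j → *-distribˡ-sum (a j) (λ i → A j i * w i μ)) ⟩
        ∑[ j < k ] ∑[ i < d ] (a j * (A j i * w i μ))
          ≈⟨ ∑-comm (λ j i → a j * (A j i * w i μ)) ⟩
        ∑[ i < d ] ∑[ j < k ] (a j * (A j i * w i μ))
          ≈⟨ sum-cong-≋ (λ i → trans (sum-cong-≋ (λ j → sym (*-assoc (a j) (A j i) (w i μ))))
                                     (sym (*-distribʳ-sum (w i μ) (λ j → a j * A j i)))) ⟩
        ∑[ i < d ] (combination a A i * w i μ)
          ≈⟨ sum-≈0 (λ i → trans (*-congʳ (a·A≈0 i)) (zeroˡ _)) ⟩
        0# ∎

-- Copies of a graph in K_n

injectiveᵇ⇒injective : ∀ {a n} {φ : Vec (Fin n) a} → T (injectiveᵇ φ) → ∀ {u w} → lookup φ u ≡ lookup φ w → u ≡ w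
injectiveᵇ⇒injective {a} {φ = φ} inj {u} {w} φu≡φw
  with Equivalence.to T-∨ (allᵇ⁻ _ (allᵇ⁻ _ inj (∈-allFin u)) (∈-allFin w))
... | inj₁ u==w   = ==⇒≡ u==w
... | inj₂ φu≠φw  = ⊥-elim (not-==⇒≢ φu≠φw φu≡φw)

edgeIndex : ∀ {n} {i j : Fin n} → toℕ i < toℕ j → ∃ λ k → edgeAt k ≡ (i , j)
edgeIndex {n} {i} {j} i<j = Any.index ij∈edges , ≡.sym (lookup-index ij∈edges)
  where
  ij∈edges : (i , j) ∈ edges n
  ij∈edges = ∈-concat⁺′ (∈-map⁺ (i ,_) (∈-filter⁺ (λ j → toℕ i ℕ.<? toℕ j) (∈-allFin j) i<j))
                        (∈-map⁺ (λ i → List.map (i ,_) (List.filter (λ j → toℕ i ℕ.<? toℕ j) (List.allFin n))) (∈-allFin i))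

imageEdges-nonempty-< : ∀ {n} (G : Graph) (φ : Vec (Fin n) (Graph.v G)) {u w} → Graph.adj G u w ≡ true →
  toℕ (lookup φ u) < toℕ (lookup φ w) → Nonempty (imageEdges G φ)
imageEdges-nonempty-< {n} G φ {u} {w} uw∈G φu<φw =
  let k , k≡φuφw = edgeIndex {n} φu<φw
  in k , lookup⇒[]= k _ (≡.trans (lookup∘tabulate _ k)
           (Equivalence.to T-≡ (≡.subst (λ (x , y) → T (hasPreimage x y)) (≡.sym k≡φuφw) φuφw-hasPreimage)))
  where
  open Graph G
  hasPreimage : _ → _ → Bool
  hasPreimage x y = anyᵇ (λ u → anyᵇ (λ w → adj u w ∧ (lookup φ u == x) ∧ (lookup φ w == y)) (List.allFin v)) (List.allFin v)
  φuφw-hasPreimage : T (hasPreimage (lookup φ u) (lookup φ w))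
  φuφw-hasPreimage = anyᵇ⁺ _ (∈-allFin u) (anyᵇ⁺ _ (∈-allFin w)
    (Equivalence.from T-∧ (Equivalence.from T-≡ uw∈G ,
      Equivalence.from T-∧ (≡⇒== {i = lookup φ u} ≡.refl , ≡⇒== {i = lookup φ w} ≡.refl))))

imageEdges-nonempty : ∀ {n} (G : Graph) (φ : Vec (Fin n) (Graph.v G)) → T (injectiveᵇ φ) →
  ∀ {u w} → Graph.adj G u w ≡ true → Nonempty (imageEdges G φ)
imageEdges-nonempty G φ injective {u} {w} uw∈G with ℕₚ.<-cmp (toℕ (lookup φ u)) (toℕ (lookup φ w))
... | tri< φu<φw _ _ = imageEdges-nonempty-< G φ uw∈G φu<φw
... | tri> _ _ φw<φu = imageEdges-nonempty-< G φ (≡.trans (Graph.sym G w u) uw∈G) φw<φu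
... | tri≈ _ φu≡φw _ with ≡.refl ← injectiveᵇ⇒injective {φ = φ} injective (toℕ-injective φu≡φw)
                         with () ← ≡.trans (≡.sym uw∈G) (Graph.irrefl G u)

copy-nonempty : ∀ {n} (F : Graph) → NoIsolated F → ∀ {A} → A ∈ copies F n → Nonempty A
copy-nonempty {n} F (0<v , neighbour) {A} A∈copies
  with φ , φ∈injective , ≡.refl ← ∈-map⁻ (imageEdges {n} F) (∈-deduplicate⁻ (_≟ES_ {n}) _ A∈copies)
  = imageEdges-nonempty F φ
      (proj₂ (∈-filter⁻ (λ φ → T? (injectiveᵇ φ)) {xs = allMaps (Graph.v F) n} φ∈injective))
      (proj₂ (neighbour (Fin.fromℕ< 0<v)))

-- n is a parameter: EdgeSet n = Subset (E n) does not determine n by unification.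
module Copies (n : ℕ) where

  meeting : Graph → EdgeSet n → List (EdgeSet n)
  meeting G M = List.filter (¬? ∘ (_⊆? ∁ M)) (copies G n)

  length-meeting : ∀ G M → length (meeting G M) ℕ.+ copiesIn G {n} (∁ M) ≡ length (copies G n)
  length-meeting G M = length-filter-¬?+length-filter (_⊆? ∁ M) (copies G n)

  copies-unique : ∀ G → Unique (copies G n)
  copies-unique G = deduplicate-! (_≟ES_ {n}) _

  FFreeᵇ⁻ : ∀ F {H} → T (FFreeᵇ F {n} H) → ∀ {A} → A ∈ copies F n → ¬ A ⊆ H
  FFreeᵇ⁻ F free A∈copies = toWitnessFalse (allᵇ⁻ _ free A∈copies)

  FFreeᵇ⁺ : ∀ F {H} → (∀ {A} → A ∈ copies F n → ¬ A ⊆ H) → T (FFreeᵇ F {n} H)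
  FFreeᵇ⁺ F no-copy = allᵇ⁺ _ (copies F n) (fromWitnessFalse ∘ no-copy)

  ⊥-FFree : ∀ F → NoIsolated F → T (FFreeᵇ F {n} ⊥)
  ⊥-FFree F F-noIsolated = FFreeᵇ⁺ F λ A∈copies A⊆⊥ →
    let e , e∈A = copy-nonempty F F-noIsolated A∈copies in ∉⊥ (A⊆⊥ e∈A)

  FFreeGraphs : Graph → List (EdgeSet n)
  FFreeGraphs F = List.filter (λ H → T? (FFreeᵇ F {n} H)) (allSubsets (E n))

  ∈-FFreeGraphs⁺ : ∀ F {H} → T (FFreeᵇ F {n} H) → H ∈ FFreeGraphs F
  ∈-FFreeGraphs⁺ F {H} = ∈-filter⁺ (λ H → T? (FFreeᵇ F {n} H)) (∈-allSubsets H)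

  ∈-FFreeGraphs⁻ : ∀ F {H} → H ∈ FFreeGraphs F → T (FFreeᵇ F {n} H)
  ∈-FFreeGraphs⁻ F H∈ = proj₂ (∈-filter⁻ (λ H → T? (FFreeᵇ F {n} H)) {xs = allSubsets (E n)} H∈)

  copiesIn≤ex : ∀ G F {H} → T (FFreeᵇ F {n} H) → copiesIn G {n} H ℕ.≤ ex n G F
  copiesIn≤ex G F free = ≤-max (copiesIn G {n}) (∈-FFreeGraphs⁺ F free)

  ex-attained : ∀ G F → NoIsolated F → ∃ λ H → T (FFreeᵇ F {n} H) × ex n G F ≡ copiesIn G {n} H
  ex-attained G F F-noIsolated =
    let H , H∈ , ex≡ = max-attained (copiesIn G {n}) (∈-FFreeGraphs⁺ F (⊥-FFree F F-noIsolated))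
    in H , ∈-FFreeGraphs⁻ F H∈ , ex≡

-- The basis of V_G(n) ∩ 𝔪_M

module _ {c ℓ} (K : Field c ℓ) (n : ℕ) where
  open Field K using (_≈_; 0#; 0≉1; sym; trans)
  open Poly K (E n)
  open Polynomials K (E n)
  open Copies n

  cover⇒∁-FFree : ∀ F {M} → yMInCover K n F M → T (FFreeᵇ F {n} (∁ M))
  cover⇒∁-FFree F {M} cover = FFreeᵇ⁺ F λ {A} A∈copies A⊆∁M →
    0≉1 (sym (trans (sym (coeff-yS-self M)) (InVarIdeal⇒coeff≈0 {p = yS M} (cover A A∈copies) (x∈∁p⇒x∉p ∘ A⊆∁M))))

  FFree⇒∁-cover : ∀ F {H} → T (FFreeᵇ F {n} H) → yMInCover K n F (∁ H)
  FFree⇒∁-cover F free A A∈copies =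
    let e , e∈A , e∈∁H = ¬⊆∁⇒meets (λ A⊆∁∁H → FFreeᵇ⁻ F free A∈copies (x∉∁p⇒x∈p ∘ x∈∁p⇒x∉p ∘ A⊆∁∁H))
    in yS-∈-InVarIdeal e∈A e∈∁H

  meeting-∈-V∩𝔪 : ∀ G M i → let p = lookup (monomials (meeting G M)) i in InV K n G p × InVarIdeal M p
  meeting-∈-V∩𝔪 G M = lookup-monomials (λ p → InV K n G p × InVarIdeal M p) (meeting G M) λ B∈meeting →
    let B∈copies , B⊈∁M = ∈-filter⁻ (¬? ∘ (_⊆? ∁ M)) {xs = copies G n} B∈meeting
        e , e∈B , e∈M = ¬⊆∁⇒meets B⊈∁M
    in yS-∈-span (copies G n) B∈copies , yS-∈-InVarIdeal e∈M e∈B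

  meeting-independent : ∀ G M → LinIndep (monomials (meeting G M))
  meeting-independent G M = monomials-independent (meeting G M) (filter⁺ (¬? ∘ (_⊆? ∁ M)) (copies-unique G))

  V∩𝔪⊆span-meeting : ∀ G M p → InV K n G p → InVarIdeal M p → InSpan (monomials (meeting G M)) p
  V∩𝔪⊆span-meeting G M p (cs , p≈) p∈𝔪M =
    let cs′ , p≈′ = lincomb-∈-span-filter (¬? ∘ (_⊆? ∁ M)) (copies G n) (copies-unique G) cs off-meeting≈0
    in cs′ , λ μ → trans (p≈ μ) (p≈′ μ)
    where
    off-meeting≈0 : ∀ {B} → B ∈ copies G n → ¬ ¬ B ⊆ ∁ M → coeff (lincomb cs (monomials (copies G n))) (exponent B) ≈ 0#
    off-meeting≈0 {B} _ ¬B⊈∁M = trans (sym (p≈ (exponent B)))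
      (InVarIdeal⇒coeff≈0 {p = p} p∈𝔪M λ e∈M e∈B → x∈∁p⇒x∉p (decidable-stable (B ⊆? ∁ M) ¬B⊈∁M e∈B) e∈M)

  dimVcapM-meeting : ∀ G M → dimVcapM K n G M (length (meeting G M))
  dimVcapM-meeting G M = ≡.subst (dimVcapM K n G M) (length-map yS (meeting G M))
    ( monomials (meeting G M) , meeting-∈-V∩𝔪 G M , meeting-independent G M
    , λ p (p∈V , p∈𝔪) → V∩𝔪⊆span-meeting G M p p∈V p∈𝔪)

  meeting≤dimVcapM : ∀ G M {d} → dimVcapM K n G M d → length (meeting G M) ℕ.≤ d
  meeting≤dimVcapM G M {d} (bs , _ , _ , bs-span) = ≡.subst (ℕ._≤ d) (length-map yS (meeting G M))
    (LinIndep-in-span⇒≤ (monomials (meeting G M)) bs (meeting-independent G M)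
      λ j → bs-span (lookup (monomials (meeting G M)) j) (meeting-∈-V∩𝔪 G M j))

-- Opened only here, as it would clash with the field addition in the modules above.
open import Data.Nat using (_+_)

theorem5p3 : ∀ {c ℓ} (K : Field c ℓ) → CharZero K →
    (T F : Graph) → NoIsolated T → NoIsolated F → (n : ℕ) →
    Σ ℕ λ a → IsAlpha K n T F a × (ex n T F + a ≡ length (copies T n))
theorem5p3 K _ T F _ F-noIsolated n
  with H , H-FFree , ex≡copiesIn-H ← Copies.ex-attained n T F F-noIsolated =
  a , ((∁ H , FFree⇒∁-cover K n F H-FFree , dimVcapM-meeting K n T (∁ H)) , minimal) ,
  ≡.trans (ℕₚ.+-comm (ex n T F) a) a+ex≡N
  where
  open Copies n
  a : ℕ
  a = length (meeting T (∁ H))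
  a+ex≡N : a + ex n T F ≡ length (copies T n)
  a+ex≡N = begin
    a + ex n T F                ≡⟨ ≡.cong (a +_) ex≡copiesIn-H ⟩
    a + copiesIn T {n} H        ≡⟨ ≡.cong (λ H′ → a + copiesIn T {n} H′) (≡.sym (∁-involutive H)) ⟩
    a + copiesIn T {n} (∁ (∁ H)) ≡⟨ length-meeting T (∁ H) ⟩
    length (copies T n)         ∎
    where open ≡.≡-Reasoning
  minimal : ∀ M d → yMInCover K n F M → dimVcapM K n T M d → a ℕ.≤ d
  minimal M d M-cover M-dim = ℕₚ.≤-trans
    (+≡+⇒≤ (≡.trans a+ex≡N (≡.sym (length-meeting T M))) (copiesIn≤ex T F (cover⇒∁-FFree K n F M-cover)))
    (meeting≤dimVcapM K n T M M-dim)
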